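{- Let $A,B$ be types and let $F:(A\to B^\nu)\to(A\to B^\nu)$ be finitary. Then $F$ is extensional: for all $f_1,f_2:A\to B^\nu$, if $f_1\equiv f_2$ then $F\,f_1\equiv F\,f_2$.
   Context: Work in an intensional constructive dependent type theory with inductive and coinductive types. For a type $B$, $B^\nu$ is the coinductive type with constructors $\mathsf{return}:B\to B^\nu$ and $\mathsf{step}:B^\nu\to B^\nu$. Convergence $x\downarrow b$ is inductive: $\mathsf{return}\,b\downarrow b$; $x\downarrow b\Rightarrow\mathsf{step}\,x\downarrow b$. Equality $x\approx y$ is coinductive: $x\downarrow b\wedge y\downarrow b\Rightarrow x\approx y$; $x\approx y\Rightarrow\mathsf{step}\,x\approx\mathsf{step}\,y$. Extensional equality of $f_1,f_2:A\to B^\nu$: $f_1\equiv f_2$ iff $\forall a:A.\,f_1\,a\approx f_2\,a$. $F$ is finitary if for every $f:A\to B^\nu$, $a:A$, $b:B$ with $F\,f\,a\downarrow b$, there exist finitely many $a_1,\dots,a_n:A$ and $b_1,\dots,b_n:B$ with $f\,a_i\downarrow b_i$ for all $i$ such that for every $g:A\to B^\nu$, if $g\,a_i\downarrow b_i$ for all $i$ then $F\,g\,a\downarrow b$. -}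

module Defs where

-- We therefore encode
-- the coinductive type B^ν as its final coalgebra in the standard way
-- (an M-type presented by a state machine), and the coinductive relation
-- ≈ as its greatest fixed point (existence of a post-fixed point, i.e. a
-- bisimulation).

open import Data.Unit using (⊤; tt)
open import Data.Sum using (_⊎_; inj₁; inj₂)
open import Data.Product using (Σ; _×_; _,_; proj₁; proj₂; ∃-syntax)
open import Data.List using (List)
open import Data.List.Relation.Unary.All using (All)
open import Relation.Binary.PropositionalEquality using (_≡_)

-- B^ν : coinductive type with constructors return : B → B^ν and
-- step : B^ν → B^ν, presented as a coalgebra for  X ↦ B ⊎ X  with a
-- chosen current state.  'next s = inj₁ b' means the state is 'return b',
-- 'next s = inj₂ s′' means the state is 'step s′'.

record Delay (B : Set) : Set₁ where
  constructor mkDelay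
  field
    State : Set
    next  : State → B ⊎ State
    start : State

open Delay public

return : {B : Set} → B → Delay B
return b = mkDelay ⊤ (λ _ → inj₁ b) tt

step : {B : Set} → Delay B → Delay B
step {B} x = mkDelay (⊤ ⊎ State x) nx (inj₁ tt)
  where
  nx : ⊤ ⊎ State x → B ⊎ (⊤ ⊎ State x)
  nx (inj₁ _) = inj₂ (inj₂ (start x))
  nx (inj₂ s) with next x s
  ... | inj₁ b  = inj₁ b
  ... | inj₂ s′ = inj₂ (inj₂ s′)

at : {B : Set} (x : Delay B) → State x → Delay B
at x s = mkDelay (State x) (next x) s

-- Convergence x ↓ b (inductive):
--   return b ↓ b ;  x ↓ b ⇒ step x ↓ b
-- stated on states of the coalgebra.

data Conv {B : Set} (x : Delay B) : State x → B → Set where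
  conv-return : ∀ {s b} → next x s ≡ inj₁ b → Conv x s b
  conv-step   : ∀ {s s′ b} → next x s ≡ inj₂ s′ → Conv x s′ b → Conv x s b

_↓_ : {B : Set} → Delay B → B → Set
x ↓ b = Conv x (start x) b

-- Equality x ≈ y (coinductive):
--   x ↓ b ∧ y ↓ b ⇒ x ≈ y ;  x ≈ y ⇒ step x ≈ step y.
-- As the greatest fixed point: x ≈ y iff there is a relation R on states
-- relating the start states which is closed under the two rules read
-- backwards (a post-fixed point of the rule functional).

IsBisim : {B : Set} (x y : Delay B) → (State x → State y → Set) → Set
IsBisim {B} x y R =
  ∀ s t → R s t →
    (∃[ b ] (Conv x s b × Conv y t b))
    ⊎ (∃[ s′ ] ∃[ t′ ] (next x s ≡ inj₂ s′ × next y t ≡ inj₂ t′ × R s′ t′))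

_≈_ : {B : Set} → Delay B → Delay B → Set₁
x ≈ y = ∃[ R ] (IsBisim x y R × R (start x) (start y))

_≡ₑ_ : {A B : Set} → (A → Delay B) → (A → Delay B) → Set₁
f₁ ≡ₑ f₂ = ∀ a → f₁ a ≈ f₂ a

Finitary : {A B : Set} → ((A → Delay B) → (A → Delay B)) → Set₁
Finitary {A} {B} F =
  ∀ (f : A → Delay B) (a : A) (b : B) → F f a ↓ b →
  Σ (List (A × B)) λ ps →
    All (λ p → f (proj₁ p) ↓ proj₂ p) ps ×
    (∀ (g : A → Delay B) → All (λ p → g (proj₁ p) ↓ proj₂ p) ps → F g a ↓ b)

Extensional : {A B : Set} → ((A → Delay B) → (A → Delay B)) → Set₁
Extensional {A} {B} F = ∀ (f₁ f₂ : A → Delay B) → f₁ ≡ₑ f₂ → F f₁ ≡ₑ F f₂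

-- Bisimilar computations converge to the same values, and conversely two
-- computations with the same values are bisimilar, since "having the same
-- values" is itself a bisimulation.  So it suffices that F f₁ a and F f₂ a
-- converge to the same values.  If F f₁ a ↓ b, finitarity yields finitely
-- many observations f₁ aᵢ ↓ bᵢ that force the value b; they transfer to f₂
-- along f₁ ≡ₑ f₂, hence F f₂ a ↓ b, and symmetrically.
module Submission where

open import Defs
open import Data.Sum using (inj₁; inj₂)
open import Data.Sum.Properties using (inj₁-injective; inj₂-injective)
open import Data.Product using (_,_; proj₁)
open import Data.Empty using (⊥-elim)
open import Data.List.Relation.Unary.All as All using ()
open import Function.Bundles using (_⇔_; mk⇔; Equivalence)
open import Relation.Binary.PropositionalEquality using (_≡_; _≢_; refl; sym; trans; subst)

private
  inj₁≢inj₂ : {X Y : Set} {u : X} {v : Y} → inj₁ u ≢ inj₂ v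
  inj₁≢inj₂ ()

module _ {B : Set} (x : Delay B) where

  Conv-functional : ∀ {s b b′} → Conv x s b → Conv x s b′ → b ≡ b′
  Conv-functional (conv-return e) (conv-return e′) = inj₁-injective (trans (sym e) e′)
  Conv-functional (conv-return e) (conv-step e′ _) = ⊥-elim (inj₁≢inj₂ (trans (sym e) e′))
  Conv-functional (conv-step e _) (conv-return e′) = ⊥-elim (inj₁≢inj₂ (trans (sym e′) e))
  Conv-functional (conv-step e c) (conv-step e′ c′)
    with inj₂-injective (trans (sym e) e′)
  ... | refl = Conv-functional c c′

  Conv-step⁻¹ : ∀ {s s′ b} → next x s ≡ inj₂ s′ → Conv x s b → Conv x s′ b
  Conv-step⁻¹ ex (conv-return e) = ⊥-elim (inj₁≢inj₂ (trans (sym e) ex))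
  Conv-step⁻¹ ex (conv-step e c) with inj₂-injective (trans (sym e) ex)
  ... | refl = c

module _ {B : Set} {x y : Delay B} {R : State x → State y → Set} (bisim : IsBisim x y R) where

  IsBisim-Conv : ∀ {s t b} → R s t → Conv x s b → Conv y t b
  IsBisim-Conv {s} {t} {b} r c with bisim s t r
  ... | inj₁ (b′ , cx , cy) = subst (Conv y t) (sym (Conv-functional x c cx)) cy
  IsBisim-Conv r (conv-return e) | inj₂ (_ , _ , ex , _ , _) =
    ⊥-elim (inj₁≢inj₂ (trans (sym e) ex))
  IsBisim-Conv r (conv-step e c) | inj₂ (_ , _ , ex , ey , r′)
    with inj₂-injective (trans (sym e) ex)
  ... | refl = conv-step ey (IsBisim-Conv r′ c)

  IsBisim-flip : IsBisim y x (λ t s → R s t)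
  IsBisim-flip t s r with bisim s t r
  ... | inj₁ (b , cx , cy) = inj₁ (b , cy , cx)
  ... | inj₂ (s′ , t′ , ex , ey , r′) = inj₂ (t′ , s′ , ey , ex , r′)

≈-sym : {B : Set} {x y : Delay B} → x ≈ y → y ≈ x
≈-sym (R , bisim , r) = (λ t s → R s t) , IsBisim-flip bisim , r

≈⇒↓ : {B : Set} {x y : Delay B} {b : B} → x ≈ y → x ↓ b → y ↓ b
≈⇒↓ (_ , bisim , r) = IsBisim-Conv bisim r

SameValues : {B : Set} (x y : Delay B) → State x → State y → Set
SameValues x y s t = ∀ b → Conv x s b ⇔ Conv y t b

SameValues-isBisim : {B : Set} (x y : Delay B) → IsBisim x y (SameValues x y)
SameValues-isBisim x y s t same with next x s in ex | next y t in ey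
... | inj₁ b  | _       = inj₁ (b , conv-return ex , Equivalence.to (same b) (conv-return ex))
... | inj₂ _  | inj₁ b  = inj₁ (b , Equivalence.from (same b) (conv-return ey) , conv-return ey)
... | inj₂ s′ | inj₂ t′ = inj₂ (s′ , t′ , refl , refl , same′)
  where
  same′ : SameValues x y s′ t′
  same′ b = mk⇔ (λ c → Conv-step⁻¹ y ey (Equivalence.to   (same b) (conv-step ex c)))
                (λ c → Conv-step⁻¹ x ex (Equivalence.from (same b) (conv-step ey c)))

↓⇔⇒≈ : {B : Set} {x y : Delay B} → (∀ b → x ↓ b ⇔ y ↓ b) → x ≈ y
↓⇔⇒≈ {x = x} {y} same = SameValues x y , SameValues-isBisim x y , same

Finitary-↓ : {A B : Set} {F : (A → Delay B) → (A → Delay B)} → Finitary F →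
             {f₁ f₂ : A → Delay B} → f₁ ≡ₑ f₂ → ∀ {a b} → F f₁ a ↓ b → F f₂ a ↓ b
Finitary-↓ fin {f₁} {f₂} eq {a} {b} c =
  let (_ , observed , forces) = fin f₁ a b c
  in forces f₂ (All.map (λ {p} → ≈⇒↓ (eq (proj₁ p))) observed)

lemma6p3 : {A B : Set} (F : (A → Delay B) → (A → Delay B)) →
    Finitary F → Extensional F
lemma6p3 F fin f₁ f₂ eq a =
  ↓⇔⇒≈ λ _ → mk⇔ (Finitary-↓ fin eq) (Finitary-↓ fin (λ a′ → ≈-sym (eq a′)))
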